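{- Let $h$ and $k$ be positive integers. If $a$ and $\ell$ are positive integers such that $k = a\ell$, then $\mathcal{R}_{\mathbf{Z}}(h,k)$ contains the arithmetic progression \[ \left\{ (\ell-1)hb + (a-1)h + 1 : b \in [a, (a-1)h+1] \right\}. \]
   Context: For real numbers $u\le v$, $[u,v]$ denotes the integer interval $\{n\in\mathbf{Z}: u\le n\le v\}$. For a nonempty set $A$ of integers and a positive integer $h$, $hA$ denotes the set of all sums of $h$ not necessarily distinct elements of $A$. The sumset size set is $\mathcal{R}_{\mathbf{Z}}(h,k) = \{ |hA| : A \subseteq \mathbf{Z},\ |A| = k \}$. -}

module Defs where

open import Data.Nat using (ℕ)
open import Data.Integer using (ℤ; _+_; 0ℤ)
open import Data.List using (List; length; foldr)
open import Data.List.Relation.Unary.All using (All)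
open import Data.List.Relation.Unary.Unique.Propositional using (Unique)
open import Data.List.Membership.Propositional using (_∈_)
open import Data.Product using (Σ; _×_; ∃)
open import Function.Bundles using (_⇔_)
open import Relation.Binary.PropositionalEquality using (_≡_)

sumℤ : List ℤ → ℤ
sumℤ = foldr _+_ 0ℤ

-- n ∈ hA : n is a sum of h (not necessarily distinct) elements of A
-- (A a finite set of integers, represented by a duplicate-free list).
InSumset : ℕ → List ℤ → ℤ → Set
InSumset h A n = Σ (List ℤ) λ xs → (length xs ≡ h) × All (_∈ A) xs × sumℤ xs ≡ n

-- |hA| = m : the (finite) set hA is enumerated by a duplicate-free list of length m.
SumsetSize : ℕ → List ℤ → ℕ → Set
SumsetSize h A m = Σ (List ℤ) λ L → Unique L × (∀ n → (n ∈ L ⇔ InSumset h A n)) × length L ≡ m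

-- m ∈ R_Z(h,k) : there is a set A ⊆ ℤ with |A| = k and |hA| = m.
InR : ℕ → ℕ → ℕ → Set
InR h k m = Σ (List ℤ) λ A → Unique A × length A ≡ k × SumsetSize h A m

{-# OPTIONS --safe #-}
-- Take A = {s + t b : 0 ≤ s < a, 0 ≤ t < ℓ}, an a × ℓ grid whose points are distinct
-- because a ≤ b.  Its h-fold sumset is the grid {s + t b : s ≤ (a-1)h, t ≤ (ℓ-1)h}.
-- Since b ≤ (a-1)h + 1, consecutive rows of that grid leave no gap, so hA is the whole
-- interval [0, (ℓ-1)hb + (a-1)h].
module Submission where

open import Defs
open import Data.Nat using (ℕ; _+_; _*_; _∸_; _≤_; NonZero)
open import Relation.Binary.PropositionalEquality using (_≡_)

open import Data.Nat using (zero; suc; _<_; _⊓_; z≤n; s≤s; z<s; _≤?_; _/_; _%_)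
open import Data.Nat.Properties
open import Data.Nat.DivMod
open import Data.Nat.Divisibility using (n∣m*n)
open import Data.Nat.Solver using (module +-*-Solver)
open import Data.Integer as ℤ using (ℤ; +_)
open import Data.Integer.Properties using (+-injective)
open import Data.List using (List; []; _∷_; length; map; upTo)
open import Data.List.Properties using (length-map; length-upTo)
open import Data.List.Relation.Unary.All using (All; []; _∷_)
open import Data.List.Relation.Unary.Unique.Propositional using (Unique)
open import Data.List.Relation.Unary.Unique.Propositional.Properties using (map⁺; upTo⁺)
open import Data.List.Membership.Propositional using (_∈_)
open import Data.List.Membership.Propositional.Properties using (∈-map⁺; ∈-map⁻; ∈-upTo⁺; ∈-upTo⁻)
open import Data.Product using (Σ; _×_; _,_; proj₁; proj₂)
open import Function using (_∘_)
open import Function.Bundles using (_⇔_; mk⇔)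
import Function.Properties.Equivalence as ⇔
open import Relation.Binary.PropositionalEquality using (refl; sym; trans; cong; cong₂; subst; subst₂; module ≡-Reasoning)
open import Relation.Nullary using (yes; no)

[m+kn]%n≡m : ∀ {m} k {n} .{{_ : NonZero n}} → m < n → (m + k * n) % n ≡ m
[m+kn]%n≡m {m} k {n} m<n = trans ([m+kn]%n≡m%n m k n) (m<n⇒m%n≡m m<n)

[m+kn]/n≡k : ∀ {m} k {n} .{{_ : NonZero n}} → m < n → (m + k * n) / n ≡ k
[m+kn]/n≡k {m} k {n} m<n = trans (+-distrib-/-∣ʳ m (n∣m*n k))
                                 (cong₂ _+_ (m<n⇒m/n≡0 m<n) (m*n/n≡m k n))

digits-injective : ∀ {r r′ q q′ n} .{{_ : NonZero n}} → r < n → r′ < n →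
                   r + q * n ≡ r′ + q′ * n → r ≡ r′ × q ≡ q′
digits-injective {q = q} {q′} {n} r<n r′<n eq =
  trans (sym ([m+kn]%n≡m q r<n)) (trans (cong (_% n) eq) ([m+kn]%n≡m q′ r′<n)) ,
  trans (sym ([m+kn]/n≡k q r<n)) (trans (cong (_/ n) eq) ([m+kn]/n≡k q′ r′<n))

rebase : (a b : ℕ) .{{_ : NonZero a}} → ℕ → ℕ
rebase a b m = m % a + m / a * b

rebase-digits : ∀ {a} b {s} t .{{_ : NonZero a}} → s < a → rebase a b (s + t * a) ≡ s + t * b
rebase-digits b t s<a = cong₂ (λ s t → s + t * b) ([m+kn]%n≡m t s<a) ([m+kn]/n≡k t s<a)

rebase-injective : ∀ {a b m n} .{{_ : NonZero a}} .{{_ : NonZero b}} → a ≤ b →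
                   rebase a b m ≡ rebase a b n → m ≡ n
rebase-injective {a} {b} {m} {n} a≤b eq = begin
  m                 ≡⟨ m≡m%n+[m/n]*n m a ⟩
  m % a + m / a * a ≡⟨ cong₂ (λ r q → r + q * a) (proj₁ same-digits) (proj₂ same-digits) ⟩
  n % a + n / a * a ≡⟨ m≡m%n+[m/n]*n n a ⟨
  n                 ∎
  where
  open ≡-Reasoning
  digit<b : ∀ k → k % a < b
  digit<b k = <-≤-trans (m%n<n k a) a≤b
  same-digits : m % a ≡ n % a × m / a ≡ n / a
  same-digits = digits-injective {q = m / a} {n / a} (digit<b m) (digit<b n) eq

Grid : (c d b : ℕ) → ℤ → Set
Grid c d b z = Σ ℕ λ s → Σ ℕ λ t → s ≤ c × t ≤ d × z ≡ + (s + t * b)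

-- The set A = {s + t b : s ∈ [0, a-1], t ∈ [0, ℓ-1]} of the paper, with a = c + 1 and ℓ = d + 1.
gridSet : (c d b : ℕ) → List ℤ
gridSet c d b = map (+_ ∘ rebase (suc c) b) (upTo (suc c * suc d))

length-gridSet : ∀ c d b → length (gridSet c d b) ≡ suc c * suc d
length-gridSet c d b = trans (length-map _ (upTo (suc c * suc d))) (length-upTo _)

gridSet-unique : ∀ {c d b} .{{_ : NonZero b}} → c < b → Unique (gridSet c d b)
gridSet-unique c<b =
  map⁺ (λ {m} {n} → rebase-injective {m = m} {n} c<b ∘ +-injective) (upTo⁺ _)

∈-gridSet⁻ : ∀ {c d b z} → z ∈ gridSet c d b → Grid c d b z
∈-gridSet⁻ {c} {d} {b} z∈ with ∈-map⁻ (+_ ∘ rebase (suc c) b) {xs = upTo (suc c * suc d)} z∈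
... | m , m∈ , refl = m % suc c , m / suc c , m%a≤c , m/a≤d , refl
  where
  m%a≤c : m % suc c ≤ c
  m%a≤c = m<1+n⇒m≤n (m%n<n m (suc c))
  m/a≤d : m / suc c ≤ d
  m/a≤d = m<1+n⇒m≤n (m<n*o⇒m/o<n (subst (m <_) (*-comm (suc c) (suc d)) (∈-upTo⁻ m∈)))

∈-gridSet⁺ : ∀ {c d b z} → Grid c d b z → z ∈ gridSet c d b
∈-gridSet⁺ {c} {d} {b} (s , t , s≤c , t≤d , refl) =
  subst (_∈ gridSet c d b) (cong +_ (rebase-digits b t (s≤s s≤c)))
        (∈-map⁺ (+_ ∘ rebase (suc c) b) (∈-upTo⁺ index<))
  where
  index< : s + t * suc c < suc c * suc d
  index< = begin-strict
    s + t * suc c     <⟨ +-monoˡ-< (t * suc c) (s≤s s≤c) ⟩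
    suc t * suc c     ≤⟨ *-monoˡ-≤ (suc c) (s≤s t≤d) ⟩
    suc d * suc c     ≡⟨ *-comm (suc d) (suc c) ⟩
    suc c * suc d     ∎
    where open ≤-Reasoning

+-*-interchange : ∀ s t s′ t′ b → (s + s′) + (t + t′) * b ≡ (s + t * b) + (s′ + t′ * b)
+-*-interchange = solve 5 (λ s t s′ t′ b →
  (s :+ s′) :+ (t :+ t′) :* b := (s :+ t :* b) :+ (s′ :+ t′ :* b)) refl
  where open +-*-Solver

grid-+ : ∀ {c c′ d d′ b x y} → Grid c d b x → Grid c′ d′ b y → Grid (c + c′) (d + d′) b (x ℤ.+ y)
grid-+ {b = b} (s , t , s≤c , t≤d , refl) (s′ , t′ , s′≤c′ , t′≤d′ , refl) =
  s + s′ , t + t′ , +-mono-≤ s≤c s′≤c′ , +-mono-≤ t≤d t′≤d′ , cong +_ (sym (+-*-interchange s t s′ t′ b))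

≤-+-split : ∀ c c′ {s} → s ≤ c + c′ → Σ ℕ λ s₀ → Σ ℕ λ s₁ → s₀ ≤ c × s₁ ≤ c′ × s₀ + s₁ ≡ s
≤-+-split c c′ {s} s≤ = c ⊓ s , s ∸ c , m⊓n≤m c s , m≤n+o⇒m∸n≤o s c s≤ , m⊓n+n∸m≡n c s

grid-split : ∀ {c c′ d d′ b z} → Grid (c + c′) (d + d′) b z →
             Σ ℤ λ x → Σ ℤ λ y → Grid c d b x × Grid c′ d′ b y × x ℤ.+ y ≡ z
grid-split {c} {c′} {d} {d′} {b} (s , t , s≤ , t≤ , refl)
  with ≤-+-split c c′ s≤ | ≤-+-split d d′ t≤
... | s₀ , s₁ , s₀≤c , s₁≤c′ , refl | t₀ , t₁ , t₀≤d , t₁≤d′ , refl =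
  _ , _ , (s₀ , t₀ , s₀≤c , t₀≤d , refl) , (s₁ , t₁ , s₁≤c′ , t₁≤d′ , refl) ,
  cong +_ (sym (+-*-interchange s₀ t₀ s₁ t₁ b))

sum-grid : ∀ {A c d b xs} → (∀ {x} → x ∈ A → Grid c d b x) →
           All (_∈ A) xs → Grid (length xs * c) (length xs * d) b (sumℤ xs)
sum-grid A⊆grid []           = 0 , 0 , z≤n , z≤n , refl
sum-grid A⊆grid (x∈ ∷ xs∈A) = grid-+ (A⊆grid x∈) (sum-grid A⊆grid xs∈A)

sumset⊆grid : ∀ {A c d b} h {z} → (∀ {x} → x ∈ A → Grid c d b x) →
              InSumset h A z → Grid (h * c) (h * d) b z
sumset⊆grid _ A⊆grid (xs , refl , xs∈A , refl) = sum-grid A⊆grid xs∈A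

grid⊆sumset : ∀ {A c d b} h {z} → (∀ {x} → Grid c d b x → x ∈ A) →
              Grid (h * c) (h * d) b z → InSumset h A z
grid⊆sumset zero    grid⊆A (_ , _ , z≤n , z≤n , refl) = [] , refl , [] , refl
grid⊆sumset {c = c} {d} (suc h) grid⊆A g with grid-split {c} {h * c} {d} {h * d} g
... | x , y , gx , gy , refl with grid⊆sumset h grid⊆A gy
... | ys , refl , ys∈A , refl = x ∷ ys , refl , grid⊆A gx ∷ ys∈A , refl

sumset-gridSet⇔grid : ∀ {c d b} h z → InSumset h (gridSet c d b) z ⇔ Grid (c * h) (d * h) b z
sumset-gridSet⇔grid {c} {d} {b} h z =
  mk⇔ (subst₂ Grid′ (*-comm h c) (*-comm h d) ∘ sumset⊆grid h ∈-gridSet⁻)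
      (grid⊆sumset h ∈-gridSet⁺ ∘ subst₂ Grid′ (*-comm c h) (*-comm d h))
  where
  Grid′ : ℕ → ℕ → Set
  Grid′ c d = Grid c d b z

interval : ℕ → List ℤ
interval n = map +_ (upTo n)

-- Since b ≤ c + 1, n = (n mod b) + (n div b) b is a grid point unless n div b > d,
-- in which case n lies in the top row t = d.
grid-decompose : ∀ {c d b n} .{{_ : NonZero b}} → b ≤ c + 1 → n ≤ d * b + c → Grid c d b (+ n)
grid-decompose {c} {d} {b} {n} b≤c+1 n≤ with n / b ≤? d
... | yes n/b≤d = n % b , n / b , n%b≤c , n/b≤d , cong +_ (m≡m%n+[m/n]*n n b)
  where
  n%b≤c : n % b ≤ c
  n%b≤c = m<1+n⇒m≤n (<-≤-trans (m%n<n n b) (subst (b ≤_) (+-comm c 1) b≤c+1))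
... | no n/b≰d =
  n ∸ d * b , d , m≤n+o⇒m∸n≤o n (d * b) n≤ , ≤-refl , cong +_ (sym (m∸n+n≡m d*b≤n))
  where
  d*b≤n : d * b ≤ n
  d*b≤n = ≤-trans (*-monoˡ-≤ b (<⇒≤ (≰⇒> n/b≰d))) (m/n*n≤m n b)

grid⇔interval : ∀ {c d b} .{{_ : NonZero b}} → b ≤ c + 1 →
                ∀ z → Grid c d b z ⇔ z ∈ interval (d * b + c + 1)
grid⇔interval {c} {d} {b} b≤c+1 z = mk⇔ to from
  where
  to : Grid c d b z → z ∈ interval (d * b + c + 1)
  to (s , t , s≤c , t≤d , refl) = ∈-map⁺ +_ (∈-upTo⁺ (begin-strict
    s + t * b      ≤⟨ +-mono-≤ s≤c (*-monoˡ-≤ b t≤d) ⟩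
    c + d * b      ≡⟨ +-comm c (d * b) ⟩
    d * b + c      <⟨ m<m+n (d * b + c) z<s ⟩
    d * b + c + 1  ∎))
    where open ≤-Reasoning
  from : z ∈ interval (d * b + c + 1) → Grid c d b z
  from z∈ with ∈-map⁻ +_ {xs = upTo (d * b + c + 1)} z∈
  ... | n , n∈ , refl =
    grid-decompose b≤c+1 (m<1+n⇒m≤n (subst (n <_) (+-comm (d * b + c) 1) (∈-upTo⁻ n∈)))

sumsetSize-interval : ∀ {h A n} → (∀ z → InSumset h A z ⇔ z ∈ interval n) → SumsetSize h A n
sumsetSize-interval {n = n} hA≡interval =
  interval n , map⁺ +-injective (upTo⁺ n) , (λ z → ⇔.sym (hA≡interval z)) ,
  trans (length-map +_ (upTo n)) (length-upTo n)

mainTheorem3 : (h k a ℓ : ℕ) → .{{_ : NonZero h}} → .{{_ : NonZero k}} → .{{_ : NonZero a}} → .{{_ : NonZero ℓ}}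
    → k ≡ a * ℓ
    → (b : ℕ) → a ≤ b → b ≤ (a ∸ 1) * h + 1
    → InR h k ((ℓ ∸ 1) * h * b + (a ∸ 1) * h + 1)
mainTheorem3 h _ (suc c) (suc d) refl b@(suc _) c<b b≤c*h+1 =
  gridSet c d b , gridSet-unique c<b , length-gridSet c d b ,
  sumsetSize-interval (λ z → ⇔.trans (sumset-gridSet⇔grid h z) (grid⇔interval b≤c*h+1 z))
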